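{- Let $\Sigma$ be a set, $A\in\mathrm{Abs}(\wp(\Sigma))$ an abstract domain given by a Galois insertion $(\alpha,\wp(\Sigma),A,\gamma)$, and $F\subseteq\mathrm{Fun}(\wp(\Sigma))$. Let $\mathscr{L}_{A,F}$ be the language whose atoms are the elements $a\in A$ and whose operators are the functions $f\in F$, with semantic structure $\mathcal{S}_{A,F}=(\Sigma, I_A\cup I_F)$ where $I_A(a)=\gamma(a)$ and $I_F(f)=f$. Assume $\mathscr{L}_{A,F}$ is closed under infinite logical conjunction. Then $\mathrm{AD}_{\mathscr{L}_{A,F}} = \mathscr{S}_F(A)$.
   Context: $\mathrm{Fun}(\wp(\Sigma))$ is the set of functions $f:\wp(\Sigma)^n\to\wp(\Sigma)$, $n\ge0$. A language with atoms and operators has formulas $\varphi::=a\mid f(\varphi_1,\dots,\varphi_n)$, with concrete semantics $[\![a]\!]=I_A(a)$, $[\![f(\vec\varphi)]\!]=f([\![\varphi_1]\!],\dots,[\![\varphi_n]\!])$. It is closed under infinite logical conjunction if for every set $\Phi$ of formulas there is $\psi$ with $[\![\psi]\!]=\bigcap_{\varphi\in\Phi}[\![\varphi]\!]$ (with $\bigcap\varnothing=\Sigma$). $\mathrm{AD}_{\mathscr{L}}$ is the abstract domain of $\wp(\Sigma)_\subseteq$ whose closure has image the set of all intersections of families of sets $[\![\varphi]\!]$, $\varphi\in\mathscr{L}$. Abstract domains are identified with their closures $\mu_A=\gamma\circ\alpha$ (upper closure operators on $\wp(\Sigma)$), ordered by $A_1\sqsubseteq A_2$ iff $\mu_{A_1}\subseteq\mu_{A_2}$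 pointwise. A closure $\mu$ is forward complete for an $n$-ary $f$ if $f(\mu(X_1),\dots,\mu(X_n))=\mu(f(\mu(X_1),\dots,\mu(X_n)))$ for all $X_i$ (for $n=0$: $\mu(f)=f$). $\mathscr{S}_F(A)$, the forward $F$-complete shell of $A$, is the most abstract domain that refines $A$ (is $\sqsubseteq A$) and is forward complete for every $f\in F$; it always exists. -}

module Defs where

open import Level using (0ℓ)
open import Data.Nat using (ℕ)
open import Data.Fin using (Fin)
open import Data.Product using (Σ-syntax; ∃-syntax; _×_; _,_)
open import Function using (_∘_)
open import Relation.Unary using (Pred; _⊆_; _≐_)

-- ℘(S): subsets of a carrier S, as (Set-valued) predicates; set equality is _≐_.
℘ : Set → Set₁
℘ S = Pred S 0ℓ

⋂ : {S : Set} {I : Set} → (I → ℘ S) → ℘ S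
⋂ Xs x = ∀ i → Xs i x

FunN : Set → ℕ → Set₁
FunN S n = (Fin n → ℘ S) → ℘ S

FunSet : Set → Set₂
FunSet S = (n : ℕ) → FunN S n → Set₁

-- A function on sets respects set equality (automatic for set-theoretic functions).
Extensional : {S : Set} {n : ℕ} → FunN S n → Set₁
Extensional {S} {n} f = (Xs Ys : Fin n → ℘ S) → (∀ i → Xs i ≐ Ys i) → f Xs ≐ f Ys

-- Upper closure operators on ℘(S)_⊆ (abstract domains are identified with them).
record IsUCO {S : Set} (μ : ℘ S → ℘ S) : Set₁ where
  field
    monotone   : ∀ {X Y} → X ⊆ Y → μ X ⊆ μ Y
    extensive  : ∀ X → X ⊆ μ X
    idempotent : ∀ X → μ (μ X) ≐ μ X

_⊑_ : {S : Set} → (℘ S → ℘ S) → (℘ S → ℘ S) → Set₁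
μ₁ ⊑ μ₂ = ∀ X → μ₁ X ⊆ μ₂ X

ForwardComplete : {S : Set} → (℘ S → ℘ S) → {n : ℕ} → FunN S n → Set₁
ForwardComplete μ f = ∀ Xs → f (μ ∘ Xs) ≐ μ (f (μ ∘ Xs))

ForwardCompleteAll : {S : Set} → FunSet S → (℘ S → ℘ S) → Set₁
ForwardCompleteAll F μ = ∀ n (f : FunN _ n) → F n f → ForwardComplete μ f

IsCompleteShell : {S : Set} → FunSet S → (℘ S → ℘ S) → (℘ S → ℘ S) → Set₁
IsCompleteShell F μA μ =
  IsUCO μ × (μ ⊑ μA) × ForwardCompleteAll F μ ×
  (∀ ν → IsUCO ν → ν ⊑ μA → ForwardCompleteAll F ν → ν ⊑ μ)

-- The language L_{A,F}: atoms are the elements a of A (the fixpoints of μA,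
-- i.e. the sets γ(a)), operators are the f ∈ F.
module Lang {S : Set} (μA : ℘ S → ℘ S) (F : FunSet S) where

  data Formula : Set₁ where
    atom : (a : ℘ S) → μA a ≐ a → Formula
    op   : (n : ℕ) (f : FunN S n) → F n f → (Fin n → Formula) → Formula

  ⟦_⟧ : Formula → ℘ S
  ⟦ atom a _ ⟧ = a
  ⟦ op n f _ φs ⟧ = f (λ i → ⟦ φs i ⟧)

  ClosedUnderInfConj : Set₁
  ClosedUnderInfConj =
    (I : Set) (Φ : I → Formula) → Σ[ ψ ∈ Formula ] ⟦ ψ ⟧ ≐ ⋂ (λ i → ⟦ Φ i ⟧)

  -- μ is (the closure of) AD_L: a uco whose image is the set of all
  -- intersections of families of sets ⟦φ⟧.
  IsAD : (℘ S → ℘ S) → Set₁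
  IsAD μ =
    IsUCO μ ×
    (∀ (Y : ℘ S) →
      ((∃[ X ] Y ≐ μ X) → Σ[ I ∈ Set ] Σ[ Φ ∈ (I → Formula) ] Y ≐ ⋂ (λ i → ⟦ Φ i ⟧)) ×
      ((Σ[ I ∈ Set ] Σ[ Φ ∈ (I → Formula) ] Y ≐ ⋂ (λ i → ⟦ Φ i ⟧)) → ∃[ X ] Y ≐ μ X))

{-# OPTIONS --safe #-}
module Submission where

open import Defs
open import Data.Fin using (Fin)
open import Data.Unit using (⊤; tt)
open import Data.Product using (Σ-syntax; _,_; proj₁; proj₂)
open import Function using (_∘_)
open import Relation.Unary using (_⊆_; _≐_)
open import Relation.Unary.Properties using (≐-refl; ≐-sym)

-- The image of a closure is exactly its set of fixpoints, and a closure maps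
-- X to the least fixpoint above X. The image of AD_L is the set of
-- intersections of formula denotations; closure of L under conjunction makes
-- each of these a single denotation ⟦ψ⟧. So the fixpoints of AD_L contain every
-- γ(a) (hence AD_L ⊑ A) and are closed under every f ∈ F (hence forward
-- completeness). Conversely, any ν ⊑ A forward complete for F fixes every
-- atom and, by induction on formulas, every ⟦φ⟧, hence every intersection of
-- them, i.e. every fixpoint of AD_L; this gives ν ⊑ AD_L.

module UCO {S : Set} {μ : ℘ S → ℘ S} (isUCO : IsUCO μ) where
  open IsUCO isUCO

  Fixed : ℘ S → Set
  Fixed Y = μ Y ⊆ Y

  image-fixed : ∀ {X Y} → Y ≐ μ X → Fixed Y
  image-fixed {X} (Y⊆μX , μX⊆Y) = μX⊆Y ∘ proj₁ (idempotent X) ∘ monotone Y⊆μX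

  fixed-resp-≐ : ∀ {Y Z} → Y ≐ Z → Fixed Y → Fixed Z
  fixed-resp-≐ (Y⊆Z , Z⊆Y) fixedY = Y⊆Z ∘ fixedY ∘ monotone Z⊆Y

  fixed-⋂ : ∀ {I : Set} {Ys : I → ℘ S} → (∀ i → Fixed (Ys i)) → Fixed (⋂ Ys)
  fixed-⋂ fixedYs y∈μ⋂ i = fixedYs i (monotone (λ y∈⋂ → y∈⋂ i) y∈μ⋂)

  least-fixed : ∀ {X Y} → X ⊆ Y → Fixed Y → μ X ⊆ Y
  least-fixed X⊆Y fixedY = fixedY ∘ monotone X⊆Y

  fixed-complete : ∀ {n} {f : FunN S n} → Extensional f → ForwardComplete μ f →
                   ∀ {Ys} → (∀ i → Fixed (Ys i)) → Fixed (f Ys)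
  fixed-complete {f = f} ext complete {Ys} fixedYs =
    fixed-resp-≐ (≐-sym (ext Ys (μ ∘ Ys) Ys≐μYs)) (image-fixed (complete Ys))
    where
      Ys≐μYs : ∀ i → Ys i ≐ μ (Ys i)
      Ys≐μYs i = extensive (Ys i) , fixedYs i

module _ {S : Set} {μA : ℘ S → ℘ S} {F : FunSet S}
         (ext : ∀ n (f : FunN S n) → F n f → Extensional f) where
  open Lang μA F

  ⟦⟧-fixed-by-complete-refinement :
    ∀ {ν} (isUCOν : IsUCO ν) → ν ⊑ μA → ForwardCompleteAll F ν →
    (φ : Formula) → UCO.Fixed isUCOν ⟦ φ ⟧
  ⟦⟧-fixed-by-complete-refinement isUCOν ν⊑μA complete (atom a μAa≐a) =
    proj₁ μAa≐a ∘ ν⊑μA a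
  ⟦⟧-fixed-by-complete-refinement isUCOν ν⊑μA complete (op n f Ff φs) =
    UCO.fixed-complete isUCOν (ext n f Ff) (complete n f Ff)
      (λ i → ⟦⟧-fixed-by-complete-refinement isUCOν ν⊑μA complete (φs i))

module _ {S : Set} {μA : ℘ S → ℘ S} {F : FunSet S} {μ : ℘ S → ℘ S} where
  open Lang μA F

  AD-closure-as-⋂ : IsAD μ → ∀ X →
                    Σ[ I ∈ Set ] Σ[ Φ ∈ (I → Formula) ] μ X ≐ ⋂ (λ i → ⟦ Φ i ⟧)
  AD-closure-as-⋂ (_ , image) X = proj₁ (image (μ X)) (X , ≐-refl)

  AD-closure-as-formula : ClosedUnderInfConj → IsAD μ → ∀ X →
                          Σ[ ψ ∈ Formula ] μ X ≐ ⟦ ψ ⟧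
  AD-closure-as-formula conj ad X with AD-closure-as-⋂ ad X
  ... | I , Φ , μX≐⋂Φ with conj I Φ
  ... | ψ , (ψ⊆⋂Φ , ⋂Φ⊆ψ) = ψ , (⋂Φ⊆ψ ∘ proj₁ μX≐⋂Φ , proj₂ μX≐⋂Φ ∘ ψ⊆⋂Φ)

  ⟦⟧-fixed-by-AD : (ad : IsAD μ) (φ : Formula) → UCO.Fixed (proj₁ ad) ⟦ φ ⟧
  ⟦⟧-fixed-by-AD (isUCOμ , image) φ =
    UCO.image-fixed isUCOμ (proj₂ (proj₂ (image ⟦ φ ⟧) (⊤ , (λ _ → φ) , φ≐⋂singleton)))
    where
      φ≐⋂singleton : ⟦ φ ⟧ ≐ ⋂ {I = ⊤} (λ _ → ⟦ φ ⟧)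
      φ≐⋂singleton = (λ x∈φ _ → x∈φ) , (λ x∈⋂ → x∈⋂ tt)

theorem6p7 : {S : Set} (μA : ℘ S → ℘ S) → IsUCO μA →
    (F : FunSet S) → (∀ n (f : FunN S n) → F n f → Extensional f) →
    Lang.ClosedUnderInfConj μA F →
    (μ : ℘ S → ℘ S) → Lang.IsAD μA F μ →
    IsCompleteShell F μA μ
theorem6p7 {S} μA isUCOA F ext conj μ ad@(isUCOμ , _) =
  isUCOμ , refines , complete , coarsest
  where
    open Lang μA F
    module Uμ = UCO isUCOμ

    refines : μ ⊑ μA
    refines X = Uμ.least-fixed (IsUCO.extensive isUCOA X)
                  (⟦⟧-fixed-by-AD ad (atom (μA X) (IsUCO.idempotent isUCOA X)))

    complete : ForwardCompleteAll F μ
    complete n f Ff Xs = IsUCO.extensive isUCOμ _ ,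
      Uμ.fixed-resp-≐ (≐-sym (ext n f Ff _ _ μXs≐ψs)) (⟦⟧-fixed-by-AD ad (op n f Ff ψs))
      where
        ψs : Fin n → Formula
        ψs i = proj₁ (AD-closure-as-formula conj ad (Xs i))
        μXs≐ψs : ∀ i → μ (Xs i) ≐ ⟦ ψs i ⟧
        μXs≐ψs i = proj₂ (AD-closure-as-formula conj ad (Xs i))

    coarsest : ∀ ν → IsUCO ν → ν ⊑ μA → ForwardCompleteAll F ν → ν ⊑ μ
    coarsest ν isUCOν ν⊑μA completeν X with AD-closure-as-⋂ ad X
    ... | I , Φ , μX≐⋂Φ =
      UCO.least-fixed isUCOν (IsUCO.extensive isUCOμ X)
        (UCO.fixed-resp-≐ isUCOν (≐-sym μX≐⋂Φ) (UCO.fixed-⋂ isUCOν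
          (⟦⟧-fixed-by-complete-refinement ext isUCOν ν⊑μA completeν ∘ Φ)))
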